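{- If $\Gamma_1$ is an induced (full) subgraph of $\Gamma_2$, then the map $H(\Gamma_1)\to H(\Gamma_2)$ induced by the inclusion $\Gamma_1\to\Gamma_2$ is injective.
   Context: Let $\Bbbk$ be a field. For a finite simple graph $\Gamma$ with vertices $t_1,\dots,t_s$, $A=\Bbbk[t_1,\dots,t_s]$; each edge $\{t_i,t_j\}$ gives a degree-1 generator $e_{t_it_j}$; the Koszul complex $K(\Gamma)$ is the exterior algebra over $A$ on them with $A$-linear graded-derivation differential $d(e_{t_it_j})=t_it_j$; $H(\Gamma)$ its homology. For a subgraph $\Gamma_1\subseteq\Gamma_2$, the inclusion $\Bbbk[V(\Gamma_1)]\subseteq\Bbbk[V(\Gamma_2)]$ together with $e_{t_it_j}\mapsto e_{t_it_j}$ gives a morphism of complexes $K(\Gamma_1)\to K(\Gamma_2)$, inducing $H(\Gamma_1)\to H(\Gamma_2)$. An induced subgraph contains every edge of $\Gamma_2$ joining two of its vertices. -}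

module Defs where

open import Level using (Level; _⊔_) renaming (suc to lsuc)
open import Algebra.Bundles using (CommutativeRing)
open import Data.Nat as ℕ using (ℕ; zero; suc)
open import Data.Bool using (Bool; true; false; if_then_else_)
import Data.Bool.Properties as BoolP
open import Data.Fin as Fin using (Fin)
import Data.Fin.Properties as FinP
open import Data.Vec as Vec using (Vec; []; _∷_; lookup; tabulate)
import Data.Vec.Properties as VecP
open import Data.Nat.ListAction using () renaming (sum to sumℕ)
open import Data.Bool.ListAction using () renaming (any to anyB)
open import Data.List as List using (List; []; _∷_; _++_; concatMap; allFin)
open import Data.Product using (Σ; ∃; _×_; _,_; proj₁; proj₂)
open import Data.Sum using (_⊎_)
open import Relation.Nullary using (¬_; Dec; yes; no; does)
open import Relation.Binary.PropositionalEquality using (_≡_)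

record Field (c ℓ : Level) : Set (lsuc (c ⊔ ℓ)) where
  field
    commutativeRing : CommutativeRing c ℓ
  open CommutativeRing commutativeRing public
  field
    0≉1     : ¬ (0# ≈ 1#)
    inverse : ∀ x → ¬ (x ≈ 0#) → ∃ λ y → x * y ≈ 1#

-- Vertices are Fin n (vertex i stands for the variable t_i).
-- Edges are enumerated as Fin m; edge r joins proj₁ (edge r) < proj₂ (edge r)
-- (so no loops), and distinct indices give distinct edges (no multi-edges).
-- The enumeration order of the edges fixes the order of the exterior
-- generators e_r.

record Graph : Set where
  field
    n        : ℕ
    m        : ℕ
    edge     : Fin m → Fin n × Fin n
    ordered  : ∀ r → proj₁ (edge r) Fin.< proj₂ (edge r)
    edge-inj : ∀ r r' → edge r ≡ edge r' → r ≡ r'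

open Graph

SamePair : ∀ {n} → Fin n × Fin n → Fin n × Fin n → Set
SamePair (x , y) (a , b) = (x ≡ a × y ≡ b) ⊎ (x ≡ b × y ≡ a)

record Subgraph (Γ₁ Γ₂ : Graph) : Set where
  field
    vmap     : Fin (n Γ₁) → Fin (n Γ₂)
    vmap-inj : ∀ a b → vmap a ≡ vmap b → a ≡ b
    emap     : Fin (m Γ₁) → Fin (m Γ₂)
    emap-ok  : ∀ r → SamePair (edge Γ₂ (emap r))
                        (vmap (proj₁ (edge Γ₁ r)) , vmap (proj₂ (edge Γ₁ r)))

open Subgraph

IsInduced : ∀ {Γ₁ Γ₂} → Subgraph Γ₁ Γ₂ → Set
IsInduced {Γ₁} {Γ₂} ι =
  ∀ (q : Fin (m Γ₂)) (a b : Fin (n Γ₁)) →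
    SamePair (edge Γ₂ q) (vmap ι a , vmap ι b) →
    ∃ λ (r : Fin (m Γ₁)) → emap ι r ≡ q

-- A basis element of K(Γ) as a 𝕜-vector space is t^α e_S, where
-- α : Vec ℕ n is an exponent vector (a monomial of A = 𝕜[t_1..t_n]) and
-- S : Vec Bool m is a subset of the edges, e_S = e_{r1} ∧ ... ∧ e_{rk}
-- with r1 < ... < rk the elements of S.
-- An element of K(Γ) is a finite formal sum (a list) of terms c · t^α e_S;
-- two elements are equal when all their coefficients agree.

module Koszul {c ℓ : Level} (𝕜 : Field c ℓ) where
  open Field 𝕜

  record Term (Γ : Graph) : Set c where
    constructor term
    field
      coeff : Carrier
      mono  : Vec ℕ (n Γ)
      wedge : Vec Bool (m Γ)

  K : Graph → Set c
  K Γ = List (Term Γ)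

  coef : ∀ {Γ} → K Γ → Vec ℕ (n Γ) → Vec Bool (m Γ) → Carrier
  coef [] α S = 0#
  coef (term x β T ∷ z) α S with VecP.≡-dec ℕ._≟_ β α | VecP.≡-dec BoolP._≟_ T S
  ... | yes _ | yes _ = x + coef z α S
  ... | _     | _     = coef z α S

  _≃_ : ∀ {Γ} → K Γ → K Γ → Set ℓ
  z ≃ w = ∀ α S → coef z α S ≈ coef w α S

  0K : ∀ {Γ} → K Γ
  0K = []

  _+K_ : ∀ {Γ} → K Γ → K Γ → K Γ
  _+K_ = _++_

  -K_ : ∀ {Γ} → K Γ → K Γ
  -K_ = List.map (λ t → record t { coeff = - Term.coeff t })

  _-K_ : ∀ {Γ} → K Γ → K Γ → K Γ
  z -K w = z +K (-K w)

  neg^ : ℕ → Carrier → Carrier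
  neg^ zero    x = x
  neg^ (suc k) x = - neg^ k x

  before : ∀ {k} → Vec Bool k → Fin k → ℕ
  before (b ∷ S) Fin.zero    = 0
  before (b ∷ S) (Fin.suc r) = (if b then 1 else 0) ℕ.+ before S r

  times : ∀ {k} → Fin k → Fin k → Vec ℕ k → Vec ℕ k
  times a b α = Vec.updateAt (Vec.updateAt α a suc) b suc

  -- the differential: A-linear graded derivation with d(e_r) = t_a t_b
  -- d(t^α e_{r1}∧…∧e_{rk}) = Σ_j (-1)^(j-1) t_{a_j} t_{b_j} t^α e_{…r̂j…}
  dTerm : ∀ {Γ} → Term Γ → K Γ
  dTerm {Γ} (term x α S) = concatMap f (allFin (m Γ))
    where
    f : Fin (m Γ) → List (Term Γ)
    f r = if lookup S r
            then term (neg^ (before S r) x)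
                      (times (proj₁ (edge Γ r)) (proj₂ (edge Γ r)) α)
                      (Vec.updateAt S r (λ _ → false)) ∷ []
            else []

  d : ∀ {Γ} → K Γ → K Γ
  d = concatMap dTerm

  IsCycle : ∀ {Γ} → K Γ → Set ℓ
  IsCycle z = d z ≃ 0K

  Homologous : ∀ {Γ} → K Γ → K Γ → Set (c ⊔ ℓ)
  Homologous {Γ} z w = ∃ λ (u : K Γ) → d u ≃ (z -K w)

  -- the chain map K(Γ₁) → K(Γ₂) induced by a subgraph inclusion:
  -- t_i ↦ t_{vmap i}, e_r ↦ e_{emap r}, extended multiplicatively
  -- (reordering the wedge factors produces a sign).
  module _ {Γ₁ Γ₂ : Graph} (ι : Subgraph Γ₁ Γ₂) where

    mapMono : Vec ℕ (n Γ₁) → Vec ℕ (n Γ₂)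
    mapMono α = tabulate λ v →
      sumℕ (List.map (λ i → if does (vmap ι i Fin.≟ v) then lookup α i else 0)
                         (allFin (n Γ₁)))

    mapWedge : Vec Bool (m Γ₁) → Vec Bool (m Γ₂)
    mapWedge S = tabulate λ q →
      anyB (λ r → does (emap ι r Fin.≟ q) Data.Bool.∧ lookup S r) (allFin (m Γ₁))

    inversions : Vec Bool (m Γ₁) → ℕ
    inversions S = sumℕ (List.map (λ r → sumℕ (List.map (λ r' →
        if lookup S r Data.Bool.∧ lookup S r'
             Data.Bool.∧ does (r Fin.<? r')
             Data.Bool.∧ does (emap ι r' Fin.<? emap ι r)
        then 1 else 0) (allFin (m Γ₁)))) (allFin (m Γ₁)))

    mapK : K Γ₁ → K Γ₂
    mapK = List.map λ { (term x α S) →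
      term (neg^ (inversions S) x) (mapMono α) (mapWedge S) }

-- The inclusion K(Γ₁) → K(Γ₂) has a retraction π of complexes: π sends a basis element t^β e_T
-- of K(Γ₂) whose variables and edges all come from Γ₁ to the corresponding basis element of K(Γ₁),
-- with the sign of reordering the wedge, and every other basis element to 0. π commutes with d
-- because Γ₁ is induced: a term t_a t_b t^β e_{T∖q} of d(t^β e_T) survives only if a and b are
-- vertices of Γ₁, and then so is the edge q, so t^β e_T survived already. Hence ι z − ι w = d u
-- gives z − w = π(d u) = d(π u).
module Submission where

open import Level using (Level)
open import Defs
open import Algebra.Bundles using (CommutativeMonoid)
open import Data.Bool using (Bool; true; false; if_then_else_; _∧_; _∨_)
import Data.Bool.Properties as BoolP
open import Data.Bool.ListAction using () renaming (any to anyB)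
open import Data.Empty using (⊥-elim)
open import Data.Fin as Fin using (Fin)
import Data.Fin.Properties as FinP
open import Data.List as List using (List; []; _∷_; _++_; concatMap; allFin)
import Data.List.Properties as ListP
open import Data.Nat as ℕ using (ℕ; suc)
open import Data.Nat.ListAction using () renaming (sum to sumℕ)
import Data.Nat.Properties as ℕP
open import Data.Nat.Tactic.RingSolver using (solve-∀)
open import Data.Product using (∃; _×_; _,_; proj₁; proj₂)
open import Data.Sum using (inj₁; inj₂)
open import Data.Vec as Vec using (Vec; lookup; tabulate; updateAt)
import Data.Vec.Properties as VecP
open import Function using (id)
open import Relation.Binary.Definitions using (tri<; tri≈; tri>)
open import Relation.Binary.PropositionalEquality as ≡ using (_≡_; _≢_)
open import Relation.Nullary using (¬_; Dec; yes; no; does)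
open import Relation.Nullary.Decidable using (dec-true; dec-false; _×-dec_)

open Graph
open Subgraph

module FinSum {a ℓ} (M : CommutativeMonoid a ℓ) where
  open CommutativeMonoid M
  open import Algebra.Properties.CommutativeMonoid.Sum M public
  open import Relation.Binary.Reasoning.Setoid setoid

  sum-zero : ∀ {k} (f : Fin k → Carrier) → (∀ i → f i ≈ ε) → sum f ≈ ε
  sum-zero {ℕ.zero} f f≈ε = refl
  sum-zero {suc k} f f≈ε =
    trans (∙-cong (f≈ε Fin.zero) (sum-zero (λ i → f (Fin.suc i)) (λ i → f≈ε (Fin.suc i))))
          (identityˡ ε)

  sum-single : ∀ {k} (i : Fin k) (f : Fin k → Carrier) → (∀ j → j ≢ i → f j ≈ ε) → sum f ≈ f i
  sum-single {suc k} Fin.zero f f≈ε =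
    trans (∙-congˡ (sum-zero (λ j → f (Fin.suc j)) (λ j → f≈ε (Fin.suc j) λ ())))
          (identityʳ _)
  sum-single {suc k} (Fin.suc i) f f≈ε =
    trans (∙-cong (f≈ε Fin.zero λ ())
                  (sum-single i (λ j → f (Fin.suc j)) (λ j j≢i → f≈ε (Fin.suc j) (λ e → j≢i (FinP.suc-injective e)))))
          (identityˡ _)

  -- Each h q is written as a sum over the preimage of q, and the double sum is swapped.
  sum-reindex : ∀ {k l} (e : Fin k → Fin l) → (∀ r r' → e r ≡ e r' → r ≡ r') →
                (h : Fin l → Carrier) → (∀ q → (∀ r → e r ≢ q) → h q ≈ ε) →
                sum h ≈ sum (λ r → h (e r))
  sum-reindex {k} {l} e e-inj h h≈ε = begin
      sum h                           ≈⟨ sum-cong-≋ fiber-sum ⟩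
      sum (λ q → sum (λ r → F r q))   ≈⟨ ∑-comm (λ q r → F r q) ⟩
      sum (λ r → sum (λ q → F r q))   ≈⟨ sum-cong-≋ row-sum ⟩
      sum (λ r → h (e r))             ∎
    where
    F : Fin k → Fin l → Carrier
    F r q = if does (e r FinP.≟ q) then h q else ε
    F-off : ∀ r q → e r ≢ q → F r q ≈ ε
    F-off r q er≢q rewrite dec-false (e r FinP.≟ q) er≢q = refl
    F-on : ∀ r → F r (e r) ≈ h (e r)
    F-on r rewrite dec-true (e r FinP.≟ e r) ≡.refl = refl
    row-sum : ∀ r → sum (F r) ≈ h (e r)
    row-sum r = trans (sum-single (e r) (F r) (λ q q≢er → F-off r q (λ er≡q → q≢er (≡.sym er≡q)))) (F-on r)
    fiber-sum : ∀ q → h q ≈ sum (λ r → F r q)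
    fiber-sum q with FinP.any? (λ r → e r FinP.≟ q)
    ... | yes (r₀ , ≡.refl) =
      sym (trans (sum-single r₀ (λ r → F r (e r₀)) (λ r r≢ → F-off r (e r₀) (λ x → r≢ (e-inj _ _ x)))) (F-on r₀))
    ... | no ∄r = trans (h≈ε q (λ r x → ∄r (r , x))) (sym (sum-zero _ (λ r → F-off r q (λ x → ∄r (r , x)))))

module Σℕ = FinSum ℕP.+-0-commutativeMonoid
module Σ𝔹 = FinSum BoolP.∨-commutativeMonoid

sumℕ-map-tabulate : ∀ {A : Set} (f : A → ℕ) {k} (g : Fin k → A) →
                    sumℕ (List.map f (List.tabulate g)) ≡ Σℕ.sum (λ i → f (g i))
sumℕ-map-tabulate f {ℕ.zero} g = ≡.refl
sumℕ-map-tabulate f {suc k} g = ≡.cong (f (g Fin.zero) ℕ.+_) (sumℕ-map-tabulate f (λ i → g (Fin.suc i)))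

any-tabulate : ∀ {A : Set} (f : A → Bool) {k} (g : Fin k → A) →
               anyB f (List.tabulate g) ≡ Σ𝔹.sum (λ i → f (g i))
any-tabulate f {ℕ.zero} g = ≡.refl
any-tabulate f {suc k} g = ≡.cong (f (g Fin.zero) ∨_) (any-tabulate f (λ i → g (Fin.suc i)))

vec-ext : ∀ {A : Set} {k} (xs ys : Vec A k) → (∀ i → lookup xs i ≡ lookup ys i) → xs ≡ ys
vec-ext xs ys h =
  ≡.trans (≡.sym (VecP.tabulate∘lookup xs)) (≡.trans (VecP.tabulate-cong h) (VecP.tabulate∘lookup ys))

bit : Bool → ℕ
bit b = if b then 1 else 0

_<ᵇ_ : ∀ {k} → Fin k → Fin k → Bool
i <ᵇ j = does (i FinP.<? j)

<⇒<ᵇ : ∀ {k} {i j : Fin k} → i Fin.< j → i <ᵇ j ≡ true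
<⇒<ᵇ {i = i} {j} = dec-true (i FinP.<? j)

≮⇒<ᵇ : ∀ {k} {i j : Fin k} → ¬ (i Fin.< j) → i <ᵇ j ≡ false
≮⇒<ᵇ {i = i} {j} = dec-false (i FinP.<? j)

module KoszulLemmas {c ℓ : Level} (𝕜 : Field c ℓ) where
  open Field 𝕜
  open Koszul 𝕜

  module Basics where
    open import Algebra.Properties.AbelianGroup +-abelianGroup using (⁻¹-∙-comm)
    open import Algebra.Properties.Group +-group using (ε⁻¹≈ε; ⁻¹-involutive)
    open import Relation.Binary.Reasoning.Setoid setoid
    module Σ𝕜 = FinSum +-commutativeMonoid

    neg^-cong : ∀ k {a b} → a ≈ b → neg^ k a ≈ neg^ k b
    neg^-cong ℕ.zero a≈b = a≈b
    neg^-cong (suc k) a≈b = -‿cong (neg^-cong k a≈b)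

    neg^-0# : ∀ k → neg^ k 0# ≈ 0#
    neg^-0# ℕ.zero = refl
    neg^-0# (suc k) = trans (-‿cong (neg^-0# k)) ε⁻¹≈ε

    neg^-+ : ∀ k a b → neg^ k (a + b) ≈ neg^ k a + neg^ k b
    neg^-+ ℕ.zero a b = refl
    neg^-+ (suc k) a b = trans (-‿cong (neg^-+ k a b)) (sym (⁻¹-∙-comm _ _))

    neg^-‿ : ∀ k a → neg^ k (- a) ≈ - neg^ k a
    neg^-‿ ℕ.zero a = refl
    neg^-‿ (suc k) a = -‿cong (neg^-‿ k a)

    neg^-∘ : ∀ j k x → neg^ j (neg^ k x) ≡ neg^ (j ℕ.+ k) x
    neg^-∘ ℕ.zero k x = ≡.refl
    neg^-∘ (suc j) k x = ≡.cong -_ (neg^-∘ j k x)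

    neg^-double : ∀ j k x → neg^ (j ℕ.+ (j ℕ.+ k)) x ≈ neg^ k x
    neg^-double ℕ.zero k x = refl
    neg^-double (suc j) k x = begin
      - neg^ (j ℕ.+ suc (j ℕ.+ k)) x ≡⟨ ≡.cong (λ i → - neg^ i x) (ℕP.+-suc j (j ℕ.+ k)) ⟩
      - - neg^ (j ℕ.+ (j ℕ.+ k)) x   ≈⟨ ⁻¹-involutive _ ⟩
      neg^ (j ℕ.+ (j ℕ.+ k)) x       ≈⟨ neg^-double j k x ⟩
      neg^ k x                       ∎

    neg^-involutive : ∀ k x → neg^ k (neg^ k x) ≈ x
    neg^-involutive k x = begin
      neg^ k (neg^ k x)        ≡⟨ neg^-∘ k k x ⟩
      neg^ (k ℕ.+ k) x         ≡⟨ ≡.cong (λ i → neg^ (k ℕ.+ i) x) (≡.sym (ℕP.+-identityʳ k)) ⟩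
      neg^ (k ℕ.+ (k ℕ.+ 0)) x ≈⟨ neg^-double k 0 x ⟩
      x                        ∎

    neg^-sum : ∀ k {l} (f : Fin l → Carrier) → neg^ k (Σ𝕜.sum f) ≈ Σ𝕜.sum (λ i → neg^ k (f i))
    neg^-sum k {ℕ.zero} f = neg^-0# k
    neg^-sum k {suc l} f = trans (neg^-+ k _ _) (+-congˡ (neg^-sum k (λ i → f (Fin.suc i))))

    +-cong-neg^ : ∀ k {a b a' b'} → a ≈ neg^ k a' → b ≈ neg^ k b' → a + b ≈ neg^ k (a' + b')
    +-cong-neg^ k a≈ b≈ = trans (+-cong a≈ b≈) (sym (neg^-+ k _ _))

    coef-++ : ∀ {Γ} (xs ys : K Γ) α S → coef (xs ++ ys) α S ≈ coef xs α S + coef ys α S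
    coef-++ [] ys α S = sym (+-identityˡ _)
    coef-++ (term x β T ∷ xs) ys α S with VecP.≡-dec ℕ._≟_ β α | VecP.≡-dec BoolP._≟_ T S
    ... | yes _ | yes _ = trans (+-congˡ (coef-++ xs ys α S)) (sym (+-assoc _ _ _))
    ... | yes _ | no _  = coef-++ xs ys α S
    ... | no _  | _     = coef-++ xs ys α S

    coef-∷ : ∀ {Γ} (t : Term Γ) xs α S → coef (t ∷ xs) α S ≈ coef (t ∷ []) α S + coef xs α S
    coef-∷ t = coef-++ (t ∷ [])

    coef-‿K : ∀ {Γ} (xs : K Γ) α S → coef (-K xs) α S ≈ - coef xs α S
    coef-‿K [] α S = sym ε⁻¹≈ε
    coef-‿K (term x β T ∷ xs) α S with VecP.≡-dec ℕ._≟_ β α | VecP.≡-dec BoolP._≟_ T S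
    ... | yes _ | yes _ = trans (+-congˡ (coef-‿K xs α S)) (⁻¹-∙-comm _ _)
    ... | yes _ | no _  = coef-‿K xs α S
    ... | no _  | _     = coef-‿K xs α S

    coef-−K : ∀ {Γ} (xs ys : K Γ) α S → coef (xs -K ys) α S ≈ coef xs α S + - coef ys α S
    coef-−K xs ys α S = trans (coef-++ xs (-K ys) α S) (+-congˡ (coef-‿K ys α S))

    coef-single : ∀ {Γ} y (α : Vec ℕ (n Γ)) S → coef {Γ} (term y α S ∷ []) α S ≈ y
    coef-single y α S with VecP.≡-dec ℕ._≟_ α α | VecP.≡-dec BoolP._≟_ S S
    ... | yes _ | yes _  = +-identityʳ y
    ... | yes _ | no S≢S = ⊥-elim (S≢S ≡.refl)
    ... | no α≢α | _     = ⊥-elim (α≢α ≡.refl)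

    coef-single-≢ : ∀ {Γ} y (β α : Vec ℕ (n Γ)) T S → ¬ (β ≡ α × T ≡ S) →
                    coef {Γ} (term y β T ∷ []) α S ≈ 0#
    coef-single-≢ y β α T S ≢ with VecP.≡-dec ℕ._≟_ β α | VecP.≡-dec BoolP._≟_ T S
    ... | yes β≡α | yes T≡S = ⊥-elim (≢ (β≡α , T≡S))
    ... | yes _   | no _    = refl
    ... | no _    | _       = refl

    coef-concatMap-tabulate : ∀ {Γ} {A : Set} (f : A → K Γ) {k} (g : Fin k → A) α S →
      coef (concatMap f (List.tabulate g)) α S ≈ Σ𝕜.sum (λ i → coef (f (g i)) α S)
    coef-concatMap-tabulate f {ℕ.zero} g α S = refl
    coef-concatMap-tabulate f {suc k} g α S =
      trans (coef-++ (f (g Fin.zero)) _ α S) (+-congˡ (coef-concatMap-tabulate f (λ i → g (Fin.suc i)) α S))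

    coef-concatMap-++ : ∀ {Γ Γ'} (f : Term Γ → K Γ') xs ys α S →
      coef (concatMap f (xs ++ ys)) α S ≈ coef (concatMap f xs) α S + coef (concatMap f ys) α S
    coef-concatMap-++ f xs ys α S =
      trans (reflexive (≡.cong (λ L → coef L α S) (ListP.concatMap-++ f xs ys)))
            (coef-++ (concatMap f xs) (concatMap f ys) α S)

    dSummand : ∀ {Γ} → Carrier → Vec ℕ (n Γ) → Vec Bool (m Γ) → Fin (m Γ) → K Γ
    dSummand {Γ} x α S r =
      if lookup S r
        then term (neg^ (before S r) x) (times (proj₁ (edge Γ r)) (proj₂ (edge Γ r)) α)
                  (updateAt S r (λ _ → false)) ∷ []
        else []

    coef-dTerm : ∀ {Γ} x β T α S →
      coef (dTerm {Γ} (term x β T)) α S ≈ Σ𝕜.sum (λ r → coef (dSummand x β T r) α S)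
    coef-dTerm x β T = coef-concatMap-tabulate (dSummand x β T) id

    dSummand-true : ∀ {Γ} x α S r → lookup S r ≡ true →
      dSummand {Γ} x α S r ≡ term (neg^ (before S r) x) (times (proj₁ (edge Γ r)) (proj₂ (edge Γ r)) α)
                                   (updateAt S r (λ _ → false)) ∷ []
    dSummand-true x α S r Sr rewrite Sr = ≡.refl

    dSummand-false : ∀ {Γ} x α S r → lookup S r ≡ false → dSummand {Γ} x α S r ≡ []
    dSummand-false x α S r Sr rewrite Sr = ≡.refl

    lookup-updateAt-suc : ∀ {k} (xs : Vec ℕ k) i v → lookup xs v ℕ.≤ lookup (updateAt xs i suc) v
    lookup-updateAt-suc xs i v with v FinP.≟ i
    ... | yes ≡.refl = ℕP.≤-trans (ℕP.n≤1+n _) (ℕP.≤-reflexive (≡.sym (VecP.lookup∘updateAt v xs)))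
    ... | no v≢i = ℕP.≤-reflexive (≡.sym (VecP.lookup∘updateAt′ v i v≢i xs))

    lookup-times-≥ : ∀ {k} (a b : Fin k) β v → lookup β v ℕ.≤ lookup (times a b β) v
    lookup-times-≥ a b β v = ℕP.≤-trans (lookup-updateAt-suc β a v) (lookup-updateAt-suc (updateAt β a suc) b v)

    lookup-times-right : ∀ {k} (a b : Fin k) β → lookup (times a b β) b ≢ 0
    lookup-times-right a b β eq with ≡.trans (≡.sym (VecP.lookup∘updateAt b (updateAt β a suc))) eq
    ... | ()

    lookup-times-left : ∀ {k} (a b : Fin k) β → lookup (times a b β) a ≢ 0
    lookup-times-left a b β eq with a FinP.≟ b
    ... | yes ≡.refl = lookup-times-right a a β eq
    ... | no a≢b with ≡.trans (≡.sym (≡.trans (VecP.lookup∘updateAt′ a b {suc} a≢b (updateAt β a suc))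
                                              (VecP.lookup∘updateAt a {suc} β))) eq
    ...   | ()

    before-sum : ∀ {k} (S : Vec Bool k) r → before S r ≡ Σℕ.sum (λ i → bit (lookup S i ∧ i <ᵇ r))
    before-sum (b Vec.∷ S) Fin.zero = ≡.sym (≡.cong₂ ℕ._+_ (≡.cong bit (BoolP.∧-zeroʳ b))
       (Σℕ.sum-zero _ (λ i → ≡.cong bit (BoolP.∧-zeroʳ (lookup S i)))))
    before-sum (b Vec.∷ S) (Fin.suc r) = ≡.cong₂ ℕ._+_ (≡.cong bit (≡.sym (BoolP.∧-identityʳ b))) (before-sum S r)

  module Inclusion {Γ₁ Γ₂ : Graph} (ι : Subgraph Γ₁ Γ₂) where
    open Basics using (before-sum)
    open ≡.≡-Reasoning

    vm : Fin (n Γ₁) → Fin (n Γ₂)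
    vm = vmap ι

    em : Fin (m Γ₁) → Fin (m Γ₂)
    em = emap ι

    M : Vec ℕ (n Γ₁) → Vec ℕ (n Γ₂)
    M = mapMono ι

    W : Vec Bool (m Γ₁) → Vec Bool (m Γ₂)
    W = mapWedge ι

    inv : Vec Bool (m Γ₁) → ℕ
    inv = inversions ι

    vm-injective : ∀ {a b} → vm a ≡ vm b → a ≡ b
    vm-injective = vmap-inj ι _ _

    em-injective : ∀ r r' → em r ≡ em r' → r ≡ r'
    em-injective r r' eq =
      edge-inj Γ₁ r r' (same-ends (emap-ok ι r) (≡.subst (λ q → SamePair (edge Γ₂ q) _) (≡.sym eq) (emap-ok ι r')))
      where
      same-ends : ∀ {p} → SamePair p (vm (proj₁ (edge Γ₁ r)) , vm (proj₂ (edge Γ₁ r))) →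
                  SamePair p (vm (proj₁ (edge Γ₁ r')) , vm (proj₂ (edge Γ₁ r'))) → edge Γ₁ r ≡ edge Γ₁ r'
      same-ends (inj₁ (p₁ , p₂)) (inj₁ (q₁ , q₂)) =
        ≡.cong₂ _,_ (vm-injective (≡.trans (≡.sym p₁) q₁)) (vm-injective (≡.trans (≡.sym p₂) q₂))
      same-ends (inj₂ (p₁ , p₂)) (inj₂ (q₁ , q₂)) =
        ≡.cong₂ _,_ (vm-injective (≡.trans (≡.sym p₂) q₂)) (vm-injective (≡.trans (≡.sym p₁) q₁))
      same-ends (inj₁ (p₁ , p₂)) (inj₂ (q₁ , q₂)) = ⊥-elim (FinP.<-asym (ordered Γ₁ r)
        (≡.subst₂ Fin._<_ (vm-injective (≡.trans (≡.sym q₂) p₂)) (vm-injective (≡.trans (≡.sym q₁) p₁))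
                          (ordered Γ₁ r')))
      same-ends (inj₂ (p₁ , p₂)) (inj₁ (q₁ , q₂)) = ⊥-elim (FinP.<-asym (ordered Γ₁ r)
        (≡.subst₂ Fin._<_ (vm-injective (≡.trans (≡.sym q₁) p₁)) (vm-injective (≡.trans (≡.sym q₂) p₂))
                          (ordered Γ₁ r')))

    lookup-mapMono-vm : ∀ α i → lookup (M α) (vm i) ≡ lookup α i
    lookup-mapMono-vm α i = ≡.trans (VecP.lookup∘tabulate _ (vm i))
      (≡.trans (sumℕ-map-tabulate (λ j → if does (vm j Fin.≟ vm i) then lookup α j else 0) id)
        (≡.trans (Σℕ.sum-single i _ (λ j j≢i → ≡.cong (λ b → if b then lookup α j else 0)
                                                 (dec-false (vm j Fin.≟ vm i) (λ e → j≢i (vm-injective e)))))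
          (≡.cong (λ b → if b then lookup α i else 0) (dec-true (vm i Fin.≟ vm i) ≡.refl))))

    lookup-mapMono-outside : ∀ α v → (∀ i → vm i ≢ v) → lookup (M α) v ≡ 0
    lookup-mapMono-outside α v out = ≡.trans (VecP.lookup∘tabulate _ v)
      (≡.trans (sumℕ-map-tabulate (λ j → if does (vm j Fin.≟ v) then lookup α j else 0) id)
        (Σℕ.sum-zero _ (λ j → ≡.cong (λ b → if b then lookup α j else 0) (dec-false (vm j Fin.≟ v) (out j)))))

    lookup-mapWedge-em : ∀ S r → lookup (W S) (em r) ≡ lookup S r
    lookup-mapWedge-em S r = ≡.trans (VecP.lookup∘tabulate _ (em r))
      (≡.trans (any-tabulate (λ j → does (em j Fin.≟ em r) ∧ lookup S j) id)
        (≡.trans (Σ𝔹.sum-single r _ (λ j j≢r → ≡.cong (_∧ lookup S j)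
                                                 (dec-false (em j Fin.≟ em r) (λ e → j≢r (em-injective _ _ e)))))
          (≡.cong (_∧ lookup S r) (dec-true (em r Fin.≟ em r) ≡.refl))))

    lookup-mapWedge-outside : ∀ S q → (∀ r → em r ≢ q) → lookup (W S) q ≡ false
    lookup-mapWedge-outside S q out = ≡.trans (VecP.lookup∘tabulate _ q)
      (≡.trans (any-tabulate (λ j → does (em j Fin.≟ q) ∧ lookup S j) id)
        (Σ𝔹.sum-zero _ (λ j → ≡.cong (_∧ lookup S j) (dec-false (em j Fin.≟ q) (out j)))))

    mapMono-unique : ∀ X α → (∀ i → lookup X (vm i) ≡ lookup α i) →
                     (∀ v → (∀ i → vm i ≢ v) → lookup X v ≡ 0) → X ≡ M α
    mapMono-unique X α on off = vec-ext X (M α) pointwise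
      where
      pointwise : ∀ v → lookup X v ≡ lookup (M α) v
      pointwise v with FinP.any? (λ i → vm i Fin.≟ v)
      ... | yes (i , ≡.refl) = ≡.trans (on i) (≡.sym (lookup-mapMono-vm α i))
      ... | no ∄i = ≡.trans (off v (λ i e → ∄i (i , e))) (≡.sym (lookup-mapMono-outside α v (λ i e → ∄i (i , e))))

    mapWedge-unique : ∀ X S → (∀ r → lookup X (em r) ≡ lookup S r) →
                      (∀ q → (∀ r → em r ≢ q) → lookup X q ≡ false) → X ≡ W S
    mapWedge-unique X S on off = vec-ext X (W S) pointwise
      where
      pointwise : ∀ q → lookup X q ≡ lookup (W S) q
      pointwise q with FinP.any? (λ r → em r Fin.≟ q)
      ... | yes (r , ≡.refl) = ≡.trans (on r) (≡.sym (lookup-mapWedge-em S r))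
      ... | no ∄r = ≡.trans (off q (λ r e → ∄r (r , e))) (≡.sym (lookup-mapWedge-outside S q (λ r e → ∄r (r , e))))

    restrictMono : Vec ℕ (n Γ₂) → Vec ℕ (n Γ₁)
    restrictMono β = tabulate (λ i → lookup β (vm i))

    restrictWedge : Vec Bool (m Γ₂) → Vec Bool (m Γ₁)
    restrictWedge T = tabulate (λ r → lookup T (em r))

    restrictMono-mapMono : ∀ α → restrictMono (M α) ≡ α
    restrictMono-mapMono α = vec-ext _ _ (λ i → ≡.trans (VecP.lookup∘tabulate _ i) (lookup-mapMono-vm α i))

    restrictWedge-mapWedge : ∀ S → restrictWedge (W S) ≡ S
    restrictWedge-mapWedge S = vec-ext _ _ (λ r → ≡.trans (VecP.lookup∘tabulate _ r) (lookup-mapWedge-em S r))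

    mapMono-injective : ∀ α α' → M α ≡ M α' → α ≡ α'
    mapMono-injective α α' eq =
      ≡.trans (≡.sym (restrictMono-mapMono α)) (≡.trans (≡.cong restrictMono eq) (restrictMono-mapMono α'))

    mapWedge-injective : ∀ S S' → W S ≡ W S' → S ≡ S'
    mapWedge-injective S S' eq =
      ≡.trans (≡.sym (restrictWedge-mapWedge S)) (≡.trans (≡.cong restrictWedge eq) (restrictWedge-mapWedge S'))

    mapMono-restrictMono : ∀ β → (∀ v → (∀ i → vm i ≢ v) → lookup β v ≡ 0) → M (restrictMono β) ≡ β
    mapMono-restrictMono β off = ≡.sym (mapMono-unique β (restrictMono β) (λ i → ≡.sym (VecP.lookup∘tabulate _ i)) off)

    mapWedge-restrictWedge : ∀ T → (∀ q → (∀ r → em r ≢ q) → lookup T q ≡ false) → W (restrictWedge T) ≡ T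
    mapWedge-restrictWedge T off = ≡.sym (mapWedge-unique T (restrictWedge T) (λ r → ≡.sym (VecP.lookup∘tabulate _ r)) off)

    mapMono-updateAt : ∀ α i → updateAt (M α) (vm i) suc ≡ M (updateAt α i suc)
    mapMono-updateAt α i = mapMono-unique _ (updateAt α i suc) on off
      where
      on : ∀ j → lookup (updateAt (M α) (vm i) suc) (vm j) ≡ lookup (updateAt α i suc) j
      on j with j FinP.≟ i
      ... | yes ≡.refl = ≡.trans (VecP.lookup∘updateAt (vm i) (M α))
                           (≡.trans (≡.cong suc (lookup-mapMono-vm α i)) (≡.sym (VecP.lookup∘updateAt i α)))
      ... | no j≢i = ≡.trans (VecP.lookup∘updateAt′ (vm j) (vm i) (λ e → j≢i (vm-injective e)) (M α))
                       (≡.trans (lookup-mapMono-vm α j) (≡.sym (VecP.lookup∘updateAt′ j i j≢i α)))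
      off : ∀ v → (∀ j → vm j ≢ v) → lookup (updateAt (M α) (vm i) suc) v ≡ 0
      off v out = ≡.trans (VecP.lookup∘updateAt′ v (vm i) (λ e → out i (≡.sym e)) (M α)) (lookup-mapMono-outside α v out)

    mapWedge-updateAt : ∀ S r → updateAt (W S) (em r) (λ _ → false) ≡ W (updateAt S r (λ _ → false))
    mapWedge-updateAt S r = mapWedge-unique _ (updateAt S r (λ _ → false)) on off
      where
      on : ∀ j → lookup (updateAt (W S) (em r) (λ _ → false)) (em j) ≡ lookup (updateAt S r (λ _ → false)) j
      on j with j FinP.≟ r
      ... | yes ≡.refl = ≡.trans (VecP.lookup∘updateAt (em r) (W S)) (≡.sym (VecP.lookup∘updateAt r S))
      ... | no j≢r = ≡.trans (VecP.lookup∘updateAt′ (em j) (em r) (λ e → j≢r (em-injective _ _ e)) (W S))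
                       (≡.trans (lookup-mapWedge-em S j) (≡.sym (VecP.lookup∘updateAt′ j r j≢r S)))
      off : ∀ q → (∀ j → em j ≢ q) → lookup (updateAt (W S) (em r) (λ _ → false)) q ≡ false
      off q out = ≡.trans (VecP.lookup∘updateAt′ q (em r) (λ e → out r (≡.sym e)) (W S)) (lookup-mapWedge-outside S q out)

    mapMono-times : ∀ a b α → times (vm a) (vm b) (M α) ≡ M (times a b α)
    mapMono-times a b α =
      ≡.trans (≡.cong (λ X → updateAt X (vm b) suc) (mapMono-updateAt α a)) (mapMono-updateAt (updateAt α a suc) b)

    mapMono-times-edge : ∀ r α → times (proj₁ (edge Γ₂ (em r))) (proj₂ (edge Γ₂ (em r))) (M α)
                                 ≡ M (times (proj₁ (edge Γ₁ r)) (proj₂ (edge Γ₁ r)) α)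
    mapMono-times-edge r α with edge Γ₂ (em r) | emap-ok ι r
    ... | _ | inj₁ (≡.refl , ≡.refl) = mapMono-times _ _ α
    ... | _ | inj₂ (≡.refl , ≡.refl) =
      ≡.trans (VecP.updateAt-commutes _ _ (λ e → FinP.<-irrefl (vm-injective e) (ordered Γ₁ r)) (M α)) (mapMono-times _ _ α)

    Inverted : Vec Bool (m Γ₁) → Fin (m Γ₁) → Fin (m Γ₁) → Bool
    Inverted S i j = lookup S i ∧ lookup S j ∧ i <ᵇ j ∧ em j <ᵇ em i

    ΣΣ : (Fin (m Γ₁) → Fin (m Γ₁) → ℕ) → ℕ
    ΣΣ f = Σℕ.sum (λ i → Σℕ.sum (f i))

    ΣΣ-distrib-+ : ∀ f g → ΣΣ (λ i j → f i j ℕ.+ g i j) ≡ ΣΣ f ℕ.+ ΣΣ g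
    ΣΣ-distrib-+ f g = ≡.trans (Σℕ.sum-cong-≋ (λ i → Σℕ.∑-distrib-+ (f i) (g i)))
                               (Σℕ.∑-distrib-+ (λ i → Σℕ.sum (f i)) (λ i → Σℕ.sum (g i)))

    inversions-sum : ∀ S → inv S ≡ ΣΣ (λ i j → bit (Inverted S i j))
    inversions-sum S = ≡.trans (sumℕ-map-tabulate (λ i → sumℕ (List.map (λ j → bit (Inverted S i j)) (allFin (m Γ₁)))) id)
                               (Σℕ.sum-cong-≋ (λ i → sumℕ-map-tabulate (λ j → bit (Inverted S i j)) id))

    -- Removing r from S: with A = #{i ∈ S | i < r, em r < em i}, B = #{j ∈ S | r < j, em j < em r}
    -- and C = #{j ∈ S | j < r, em j < em r} one has inv S = inv (S ∖ r) + B + A,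
    -- before S r = A + C and before (W S) (em r) = B + C; so the two signs differ by (-1)^(2A).
    module RemoveEdge (S : Vec Bool (m Γ₁)) (r : Fin (m Γ₁)) (Sr : lookup S r ≡ true) where
      S∖r : Vec Bool (m Γ₁)
      S∖r = updateAt S r (λ _ → false)

      A B C : Fin (m Γ₁) → ℕ
      A i = bit (lookup S i ∧ i <ᵇ r ∧ em r <ᵇ em i)
      B j = bit (lookup S j ∧ r <ᵇ j ∧ em j <ᵇ em r)
      C j = bit (lookup S j ∧ j <ᵇ r ∧ em j <ᵇ em r)

      lookup-S∖r-r : lookup S∖r r ≡ false
      lookup-S∖r-r = VecP.lookup∘updateAt r {λ _ → false} S

      lookup-S∖r : ∀ i → i ≢ r → lookup S∖r i ≡ lookup S i
      lookup-S∖r i i≢r = VecP.lookup∘updateAt′ i r {λ _ → false} i≢r S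

      onRow onColumn : Fin (m Γ₁) → Fin (m Γ₁) → ℕ
      onRow i j = if does (i FinP.≟ r) then B j else 0
      onColumn i j = if does (j FinP.≟ r) then A i else 0

      Inverted-removeAt : ∀ i j → bit (Inverted S i j) ≡ bit (Inverted S∖r i j) ℕ.+ onRow i j ℕ.+ onColumn i j
      Inverted-removeAt i j with i FinP.≟ r | j FinP.≟ r
      ... | yes ≡.refl | yes ≡.refl rewrite Sr | lookup-S∖r-r | ≮⇒<ᵇ {i = i} {i} (FinP.<-irrefl ≡.refl) = ≡.refl
      ... | yes ≡.refl | no _ rewrite Sr | lookup-S∖r-r = ≡.sym (ℕP.+-identityʳ _)
      ... | no i≢r | yes ≡.refl rewrite Sr | lookup-S∖r-r | lookup-S∖r i i≢r | BoolP.∧-zeroʳ (lookup S i) = ≡.refl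
      ... | no i≢r | no j≢r rewrite lookup-S∖r i i≢r | lookup-S∖r j j≢r =
        ≡.sym (≡.trans (ℕP.+-identityʳ _) (ℕP.+-identityʳ _))

      ΣΣ-onRow : ΣΣ onRow ≡ Σℕ.sum B
      ΣΣ-onRow = ≡.trans (Σℕ.sum-single r _ (λ i i≢r → Σℕ.sum-zero _ (λ j →
                              ≡.cong (λ b → if b then B j else 0) (dec-false (i FinP.≟ r) i≢r))))
                         (Σℕ.sum-cong-≋ (λ j → ≡.cong (λ b → if b then B j else 0) (dec-true (r FinP.≟ r) ≡.refl)))

      ΣΣ-onColumn : ΣΣ onColumn ≡ Σℕ.sum A
      ΣΣ-onColumn = Σℕ.sum-cong-≋ (λ i →
        ≡.trans (Σℕ.sum-single r _ (λ j j≢r → ≡.cong (λ b → if b then A i else 0) (dec-false (j FinP.≟ r) j≢r)))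
                (≡.cong (λ b → if b then A i else 0) (dec-true (r FinP.≟ r) ≡.refl)))

      inversions-removeAt : inv S ≡ inv S∖r ℕ.+ Σℕ.sum B ℕ.+ Σℕ.sum A
      inversions-removeAt = begin
        inv S
          ≡⟨ inversions-sum S ⟩
        ΣΣ (λ i j → bit (Inverted S i j))
          ≡⟨ Σℕ.sum-cong-≋ (λ i → Σℕ.sum-cong-≋ (Inverted-removeAt i)) ⟩
        ΣΣ (λ i j → bit (Inverted S∖r i j) ℕ.+ onRow i j ℕ.+ onColumn i j)
          ≡⟨ ≡.trans (ΣΣ-distrib-+ _ onColumn) (≡.cong (ℕ._+ ΣΣ onColumn) (ΣΣ-distrib-+ _ onRow)) ⟩
        ΣΣ (λ i j → bit (Inverted S∖r i j)) ℕ.+ ΣΣ onRow ℕ.+ ΣΣ onColumn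
          ≡⟨ ≡.cong₂ (λ x y → x ℕ.+ y ℕ.+ ΣΣ onColumn) (≡.sym (inversions-sum S∖r)) ΣΣ-onRow ⟩
        inv S∖r ℕ.+ Σℕ.sum B ℕ.+ ΣΣ onColumn
          ≡⟨ ≡.cong (inv S∖r ℕ.+ Σℕ.sum B ℕ.+_) ΣΣ-onColumn ⟩
        inv S∖r ℕ.+ Σℕ.sum B ℕ.+ Σℕ.sum A
          ∎

      split-mapped : ∀ j → bit (lookup S j ∧ em j <ᵇ em r) ≡ B j ℕ.+ C j
      split-mapped j with lookup S j
      ... | false = ≡.refl
      ... | true with FinP.<-cmp j r
      ...   | tri< j<r _ r≮j rewrite <⇒<ᵇ j<r | ≮⇒<ᵇ r≮j = ≡.refl
      ...   | tri≈ j≮r ≡.refl _ rewrite ≮⇒<ᵇ j≮r | ≮⇒<ᵇ {i = em j} {em j} (FinP.<-irrefl ≡.refl) = ≡.refl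
      ...   | tri> j≮r _ r<j rewrite <⇒<ᵇ r<j | ≮⇒<ᵇ j≮r = ≡.sym (ℕP.+-identityʳ _)

      split-before : ∀ i → bit (lookup S i ∧ i <ᵇ r) ≡ A i ℕ.+ C i
      split-before i with lookup S i
      ... | false = ≡.refl
      ... | true with FinP.<-cmp i r
      ...   | tri≈ i≮r _ _ rewrite ≮⇒<ᵇ i≮r = ≡.refl
      ...   | tri> i≮r _ _ rewrite ≮⇒<ᵇ i≮r = ≡.refl
      ...   | tri< i<r i≢r _ with FinP.<-cmp (em i) (em r)
      ...     | tri< emi<emr _ emr≮emi rewrite <⇒<ᵇ i<r | <⇒<ᵇ emi<emr | ≮⇒<ᵇ emr≮emi = ≡.refl
      ...     | tri≈ _ emi≡emr _ = ⊥-elim (i≢r (em-injective _ _ emi≡emr))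
      ...     | tri> emi≮emr _ emr<emi rewrite <⇒<ᵇ i<r | ≮⇒<ᵇ emi≮emr | <⇒<ᵇ emr<emi = ≡.refl

      before-mapWedge : before (W S) (em r) ≡ Σℕ.sum B ℕ.+ Σℕ.sum C
      before-mapWedge = begin
        before (W S) (em r)
          ≡⟨ before-sum (W S) (em r) ⟩
        Σℕ.sum (λ q → bit (lookup (W S) q ∧ q <ᵇ em r))
          ≡⟨ Σℕ.sum-reindex em em-injective _ (λ q out →
               ≡.cong (λ b → bit (b ∧ q <ᵇ em r)) (lookup-mapWedge-outside S q out)) ⟩
        Σℕ.sum (λ j → bit (lookup (W S) (em j) ∧ em j <ᵇ em r))
          ≡⟨ Σℕ.sum-cong-≋ (λ j → ≡.trans (≡.cong (λ b → bit (b ∧ em j <ᵇ em r)) (lookup-mapWedge-em S j))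
                                           (split-mapped j)) ⟩
        Σℕ.sum (λ j → B j ℕ.+ C j)
          ≡⟨ Σℕ.∑-distrib-+ B C ⟩
        Σℕ.sum B ℕ.+ Σℕ.sum C
          ∎

      before-removeAt : before S r ≡ Σℕ.sum A ℕ.+ Σℕ.sum C
      before-removeAt = ≡.trans (before-sum S r) (≡.trans (Σℕ.sum-cong-≋ split-before) (Σℕ.∑-distrib-+ A C))

      before+inversions : before S r ℕ.+ inv S ≡ Σℕ.sum A ℕ.+ (Σℕ.sum A ℕ.+ (inv S∖r ℕ.+ before (W S) (em r)))
      before+inversions rewrite before-mapWedge | before-removeAt | inversions-removeAt =
        rearrange (Σℕ.sum A) (Σℕ.sum C) (inv S∖r) (Σℕ.sum B)
        where
        rearrange : ∀ a c i b → (a ℕ.+ c) ℕ.+ (i ℕ.+ b ℕ.+ a) ≡ a ℕ.+ (a ℕ.+ (i ℕ.+ (b ℕ.+ c)))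
        rearrange = solve-∀

  module Retraction {Γ₁ Γ₂ : Graph} (ι : Subgraph Γ₁ Γ₂) where
    open Basics
    open Inclusion ι
    open import Relation.Binary.Reasoning.Setoid setoid

    neg^-removeAt : ∀ S r x → lookup S r ≡ true →
      neg^ (before S r) (neg^ (inv S) x) ≈ neg^ (inv (updateAt S r (λ _ → false))) (neg^ (before (W S) (em r)) x)
    neg^-removeAt S r x Sr = begin
      neg^ (before S r) (neg^ (inv S) x)
        ≡⟨ neg^-∘ (before S r) (inv S) x ⟩
      neg^ (before S r ℕ.+ inv S) x
        ≡⟨ ≡.cong (λ k → neg^ k x) before+inversions ⟩
      neg^ (ΣA ℕ.+ (ΣA ℕ.+ (inv S∖r ℕ.+ before (W S) (em r)))) x
        ≈⟨ neg^-double ΣA _ x ⟩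
      neg^ (inv S∖r ℕ.+ before (W S) (em r)) x
        ≡⟨ ≡.sym (neg^-∘ (inv S∖r) (before (W S) (em r)) x) ⟩
      neg^ (inv S∖r) (neg^ (before (W S) (em r)) x)
        ∎
      where
      open RemoveEdge S r Sr
      ΣA : ℕ
      ΣA = Σℕ.sum A

    coef-single-mapped : ∀ y z α' S' α S → y ≈ neg^ (inv S') z →
      coef {Γ₁} (term y α' S' ∷ []) α S ≈ neg^ (inv S) (coef {Γ₂} (term z (M α') (W S') ∷ []) (M α) (W S))
    coef-single-mapped y z α' S' α S y≈ = by-cases (VecP.≡-dec ℕ._≟_ α' α) (VecP.≡-dec BoolP._≟_ S' S)
      where
      goal : Set ℓ
      goal = coef {Γ₁} (term y α' S' ∷ []) α S ≈ neg^ (inv S) (coef {Γ₂} (term z (M α') (W S') ∷ []) (M α) (W S))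
      mapped-≢ : ¬ (M α' ≡ M α × W S' ≡ W S) → goal
      mapped-≢ ≢ = trans (coef-single-≢ y α' α S' S (λ (e₁ , e₂) → ≢ (≡.cong M e₁ , ≡.cong W e₂)))
        (sym (trans (neg^-cong (inv S) (coef-single-≢ z (M α') (M α) (W S') (W S) ≢)) (neg^-0# (inv S))))
      by-cases : Dec (α' ≡ α) → Dec (S' ≡ S) → goal
      by-cases (yes ≡.refl) (yes ≡.refl) =
        trans (coef-single y α' S') (trans y≈ (neg^-cong (inv S') (sym (coef-single z (M α') (W S')))))
      by-cases _ (no S'≢S) = mapped-≢ (λ (_ , e) → S'≢S (mapWedge-injective _ _ e))
      by-cases (no α'≢α) _ = mapped-≢ (λ (e , _) → α'≢α (mapMono-injective _ _ e))

    coef-mapK : ∀ z α S → coef z α S ≈ neg^ (inv S) (coef (mapK ι z) (M α) (W S))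
    coef-mapK [] α S = sym (neg^-0# (inv S))
    coef-mapK (t@(term x α' S') ∷ z) α S = begin
      coef (t ∷ z) α S
        ≈⟨ coef-∷ t z α S ⟩
      coef (t ∷ []) α S + coef z α S
        ≈⟨ +-cong-neg^ (inv S) single (coef-mapK z α S) ⟩
      neg^ (inv S) (coef (t' ∷ []) (M α) (W S) + coef (mapK ι z) (M α) (W S))
        ≈⟨ neg^-cong (inv S) (sym (coef-∷ t' (mapK ι z) (M α) (W S))) ⟩
      neg^ (inv S) (coef (mapK ι (t ∷ z)) (M α) (W S))
        ∎
      where
      t' : Term Γ₂
      t' = term (neg^ (inv S') x) (M α') (W S')
      single : coef (t ∷ []) α S ≈ neg^ (inv S) (coef (t' ∷ []) (M α) (W S))
      single = coef-single-mapped x (neg^ (inv S') x) α' S' α S (sym (neg^-involutive (inv S') x))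

    InImage : Vec ℕ (n Γ₂) → Vec Bool (m Γ₂) → Set
    InImage β T = M (restrictMono β) ≡ β × W (restrictWedge T) ≡ T

    inImage? : ∀ β T → Dec (InImage β T)
    inImage? β T = VecP.≡-dec ℕ._≟_ (M (restrictMono β)) β ×-dec VecP.≡-dec BoolP._≟_ (W (restrictWedge T)) T

    retractTerm : Term Γ₂ → K Γ₁
    retractTerm (term x β T) with inImage? β T
    ... | yes _ = term (neg^ (inv (restrictWedge T)) x) (restrictMono β) (restrictWedge T) ∷ []
    ... | no _  = []

    retract : K Γ₂ → K Γ₁
    retract = concatMap retractTerm

    coef-retractTerm : ∀ t α S → coef (retractTerm t) α S ≈ neg^ (inv S) (coef (t ∷ []) (M α) (W S))
    coef-retractTerm (term x β T) α S with inImage? β T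
    ... | yes (Mβ≡β , WT≡T) =
      ≡.subst₂ (λ β' T' → coef (t₁ ∷ []) α S ≈ neg^ (inv S) (coef (term x β' T' ∷ []) (M α) (W S))) Mβ≡β WT≡T
        (coef-single-mapped _ x (restrictMono β) (restrictWedge T) α S refl)
      where
      t₁ : Term Γ₁
      t₁ = term (neg^ (inv (restrictWedge T)) x) (restrictMono β) (restrictWedge T)
    ... | no ∉image = sym (trans (neg^-cong (inv S) (coef-single-≢ x β (M α) T (W S) mapped)) (neg^-0# (inv S)))
      where
      mapped : ¬ (β ≡ M α × T ≡ W S)
      mapped (≡.refl , ≡.refl) =
        ∉image (≡.cong M (restrictMono-mapMono α) , ≡.cong W (restrictWedge-mapWedge S))

    coef-retract : ∀ v α S → coef (retract v) α S ≈ neg^ (inv S) (coef v (M α) (W S))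
    coef-retract [] α S = sym (neg^-0# (inv S))
    coef-retract (t ∷ v) α S = begin
      coef (retractTerm t ++ retract v) α S                ≈⟨ coef-++ (retractTerm t) (retract v) α S ⟩
      coef (retractTerm t) α S + coef (retract v) α S      ≈⟨ +-cong-neg^ (inv S) (coef-retractTerm t α S) (coef-retract v α S) ⟩
      neg^ (inv S) (coef (t ∷ []) (M α) (W S) + coef v (M α) (W S)) ≈⟨ neg^-cong (inv S) (sym (coef-∷ t v (M α) (W S))) ⟩
      neg^ (inv S) (coef (t ∷ v) (M α) (W S))              ∎

    coef-dSummand-mapped : ∀ x α₀ S₀ α S r →
      coef (dSummand {Γ₁} (neg^ (inv S₀) x) α₀ S₀ r) α S
        ≈ neg^ (inv S) (coef (dSummand {Γ₂} x (M α₀) (W S₀) (em r)) (M α) (W S))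
    coef-dSummand-mapped x α₀ S₀ α S r with lookup S₀ r in S₀r
    ... | false rewrite dSummand-false {Γ₂} x (M α₀) (W S₀) (em r) (≡.trans (lookup-mapWedge-em S₀ r) S₀r) =
      sym (neg^-0# (inv S))
    ... | true rewrite dSummand-true {Γ₂} x (M α₀) (W S₀) (em r) (≡.trans (lookup-mapWedge-em S₀ r) S₀r)
                     | mapMono-times-edge r α₀ | mapWedge-updateAt S₀ r =
      coef-single-mapped _ _ (times (proj₁ (edge Γ₁ r)) (proj₂ (edge Γ₁ r)) α₀) (updateAt S₀ r (λ _ → false)) α S
                         (neg^-removeAt S₀ r x S₀r)

    coef-dTerm-mapped : ∀ x α₀ S₀ α S →
      coef (dTerm {Γ₁} (term (neg^ (inv S₀) x) α₀ S₀)) α S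
        ≈ neg^ (inv S) (coef (dTerm {Γ₂} (term x (M α₀) (W S₀))) (M α) (W S))
    coef-dTerm-mapped x α₀ S₀ α S = begin
      coef (dTerm (term y α₀ S₀)) α S
        ≈⟨ coef-dTerm y α₀ S₀ α S ⟩
      Σ𝕜.sum (λ r → coef (dSummand y α₀ S₀ r) α S)
        ≈⟨ Σ𝕜.sum-cong-≋ (coef-dSummand-mapped x α₀ S₀ α S) ⟩
      Σ𝕜.sum (λ r → neg^ (inv S) (summand₂ (em r)))
        ≈⟨ sym (Σ𝕜.sum-reindex em em-injective _ off-image) ⟩
      Σ𝕜.sum (λ q → neg^ (inv S) (summand₂ q))
        ≈⟨ sym (neg^-sum (inv S) summand₂) ⟩
      neg^ (inv S) (Σ𝕜.sum summand₂)
        ≈⟨ neg^-cong (inv S) (sym (coef-dTerm x (M α₀) (W S₀) (M α) (W S))) ⟩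
      neg^ (inv S) (coef (dTerm (term x (M α₀) (W S₀))) (M α) (W S))
        ∎
      where
      y : Carrier
      y = neg^ (inv S₀) x
      summand₂ : Fin (m Γ₂) → Carrier
      summand₂ q = coef (dSummand x (M α₀) (W S₀) q) (M α) (W S)
      off-image : ∀ q → (∀ r → em r ≢ q) → neg^ (inv S) (summand₂ q) ≈ 0#
      off-image q out = trans (neg^-cong (inv S) (reflexive (≡.cong (λ L → coef L (M α) (W S))
                                (dSummand-false x (M α₀) (W S₀) q (lookup-mapWedge-outside S₀ q out)))))
                              (neg^-0# (inv S))

    module _ (induced : IsInduced ι) where
      -- If t_a t_b t^β e_{T∖q} lies in the image then t_a, t_b are vertices of Γ₁, so
      -- the edge q lies in Γ₁ as Γ₁ is induced, and then t^β e_T lies in the image too.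
      coef-dSummand-outside : ∀ x β T α S q → ¬ InImage β T → coef (dSummand {Γ₂} x β T q) (M α) (W S) ≈ 0#
      coef-dSummand-outside x β T α S q ∉image with lookup T q
      ... | false = refl
      ... | true = coef-single-≢ _ (times a b β) (M α) _ (W S) mapped
        where
        a b : Fin (n Γ₂)
        a = proj₁ (edge Γ₂ q)
        b = proj₂ (edge Γ₂ q)
        mapped : ¬ (times a b β ≡ M α × updateAt T q (λ _ → false) ≡ W S)
        mapped (tβ≡Mα , T∖q≡WS) = ∉image (mapMono-restrictMono β β-off , mapWedge-restrictWedge T T-off)
          where
          in-image : ∀ v → lookup (times a b β) v ≢ 0 → ∃ λ i → vm i ≡ v
          in-image v nonzero with FinP.any? (λ i → vm i Fin.≟ v)
          ... | yes found = found
          ... | no ∄i = ⊥-elim (nonzero (≡.trans (≡.cong (λ X → lookup X v) tβ≡Mα)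
                                                  (lookup-mapMono-outside α v (λ i e → ∄i (i , e)))))
          β-off : ∀ v → (∀ i → vm i ≢ v) → lookup β v ≡ 0
          β-off v out = ℕP.n≤0⇒n≡0 (ℕP.≤-trans (lookup-times-≥ a b β v)
            (ℕP.≤-reflexive (≡.trans (≡.cong (λ X → lookup X v) tβ≡Mα) (lookup-mapMono-outside α v out))))
          T-off : ∀ q' → (∀ r → em r ≢ q') → lookup T q' ≡ false
          T-off q' out with q' FinP.≟ q
          ... | no q'≢q = ≡.trans (≡.sym (VecP.lookup∘updateAt′ q' q q'≢q T))
                            (≡.trans (≡.cong (λ X → lookup X q') T∖q≡WS) (lookup-mapWedge-outside S q' out))
          ... | yes ≡.refl with in-image a (lookup-times-left a b β) | in-image b (lookup-times-right a b β)
          ...   | (i , vmi≡a) | (j , vmj≡b) = ⊥-elim (out _ (proj₂ (induced q i j (inj₁ (≡.sym vmi≡a , ≡.sym vmj≡b)))))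

      coef-d-retractTerm : ∀ t α S → coef (d (retractTerm t)) α S ≈ neg^ (inv S) (coef (dTerm t) (M α) (W S))
      coef-d-retractTerm (term x β T) α S with inImage? β T
      ... | yes (Mβ≡β , WT≡T) = trans (coef-++ (dTerm t₁) [] α S) (trans (+-identityʳ _)
          (≡.subst₂ (λ β' T' → coef (dTerm t₁) α S ≈ neg^ (inv S) (coef (dTerm (term x β' T')) (M α) (W S)))
                    Mβ≡β WT≡T (coef-dTerm-mapped x (restrictMono β) (restrictWedge T) α S)))
        where
        t₁ : Term Γ₁
        t₁ = term (neg^ (inv (restrictWedge T)) x) (restrictMono β) (restrictWedge T)
      ... | no ∉image = sym (trans (neg^-cong (inv S) (trans (coef-dTerm x β T (M α) (W S))
                                     (Σ𝕜.sum-zero _ (λ q → coef-dSummand-outside x β T α S q ∉image))))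
                                   (neg^-0# (inv S)))

      coef-d-retract : ∀ u α S → coef (d (retract u)) α S ≈ neg^ (inv S) (coef (d u) (M α) (W S))
      coef-d-retract [] α S = sym (neg^-0# (inv S))
      coef-d-retract (t ∷ u) α S = begin
        coef (d (retractTerm t ++ retract u)) α S
          ≈⟨ coef-concatMap-++ dTerm (retractTerm t) (retract u) α S ⟩
        coef (d (retractTerm t)) α S + coef (d (retract u)) α S
          ≈⟨ +-cong-neg^ (inv S) (coef-d-retractTerm t α S) (coef-d-retract u α S) ⟩
        neg^ (inv S) (coef (dTerm t) (M α) (W S) + coef (d u) (M α) (W S))
          ≈⟨ neg^-cong (inv S) (sym (coef-++ (dTerm t) (d u) (M α) (W S))) ⟩
        neg^ (inv S) (coef (d (t ∷ u)) (M α) (W S)) ∎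

      homologous-reflect : ∀ z w → Homologous (mapK ι z) (mapK ι w) → Homologous z w
      homologous-reflect z w (u , du≃) = retract u , λ α S → begin
        coef (d (retract u)) α S
          ≈⟨ coef-d-retract u α S ⟩
        neg^ (inv S) (coef (d u) (M α) (W S))
          ≈⟨ neg^-cong (inv S) (du≃ (M α) (W S)) ⟩
        neg^ (inv S) (coef (mapK ι z -K mapK ι w) (M α) (W S))
          ≈⟨ neg^-cong (inv S) (coef-−K (mapK ι z) (mapK ι w) (M α) (W S)) ⟩
        neg^ (inv S) (coef (mapK ι z) (M α) (W S) + - coef (mapK ι w) (M α) (W S))
          ≈⟨ trans (neg^-+ (inv S) _ _) (+-congˡ (neg^-‿ (inv S) _)) ⟩
        neg^ (inv S) (coef (mapK ι z) (M α) (W S)) + - neg^ (inv S) (coef (mapK ι w) (M α) (W S))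
          ≈⟨ sym (+-cong (coef-mapK z α S) (-‿cong (coef-mapK w α S))) ⟩
        coef z α S + - coef w α S
          ≈⟨ sym (coef-−K z w α S) ⟩
        coef (z -K w) α S
          ∎

lemma22 : ∀ {c ℓ : Level} (𝕜 : Field c ℓ) (Γ₁ Γ₂ : Graph)
            (ι : Subgraph Γ₁ Γ₂) → IsInduced ι →
            ∀ (z w : Koszul.K 𝕜 Γ₁) →
            Koszul.IsCycle 𝕜 z → Koszul.IsCycle 𝕜 w →
            Koszul.Homologous 𝕜 (Koszul.mapK 𝕜 ι z) (Koszul.mapK 𝕜 ι w) →
            Koszul.Homologous 𝕜 z w
lemma22 𝕜 Γ₁ Γ₂ ι induced z w _ _ = KoszulLemmas.Retraction.homologous-reflect 𝕜 ι induced z w
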